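{- For every $d\in\mathbb N$ there exists a simple labelling of the hypercube $Q_d$ (each edge receives exactly one time label) such that in the resulting temporal graph, the temporal shortest distance between any two vertices equals their graph distance in the static graph $Q_d$. Moreover, for every ordered pair of distinct vertices $(u,v)$ there is exactly one temporal path from $u$ to $v$; in particular, if $u$ and $v$ are adjacent, the only temporal path from $u$ to $v$ is the single edge $uv$.
   Context: $Q_d$ is the graph on $\{0,1\}^d$ where two vertices are adjacent iff they differ in exactly one coordinate. A temporal graph is a graph together with a set of time labels (positive integers) on each edge. A temporal path from $u$ to $v$ is a path $e_1,\dots,e_k$ from $u$ to $v$ (no repeated vertices) with chosen labels $t_i$ on $e_i$ satisfying $t_1<t_2<\dots<t_k$. The temporal shortest distance from $u$ to $v$ is the least number of edges of a temporal path from $u$ to $v$. -}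

module Defs where

open import Data.Nat using (ℕ; zero; suc; _≤_; _<_)
open import Data.Fin using (Fin)
open import Data.Bool using (Bool; not)
open import Data.Vec using (Vec; updateAt)
open import Data.List using (List; []; _∷_)
open import Data.Product using (Σ; _×_)
open import Data.List.Relation.Unary.Unique.Propositional using (Unique)
open import Data.List.Relation.Unary.Linked using (Linked)
open import Relation.Binary.PropositionalEquality using (_≡_)

V : ℕ → Set
V d = Vec Bool d

-- flip coordinate i ; x and y are adjacent in Q_d iff y ≡ flipAt i x for some i
flipAt : ∀ {d} → Fin d → V d → V d
flipAt i x = updateAt x i not

-- A simple labelling of Q_d: each edge {x , flipAt i x} receives exactly one
-- positive-integer label; it is given as a function of (endpoint, direction)
-- that is symmetric in the two endpoints of the edge.
record Labelling (d : ℕ) : Set where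
  field
    label    : V d → Fin d → ℕ
    symmetric : ∀ x i → label (flipAt i x) i ≡ label x i
    positive  : ∀ x i → 1 ≤ label x i
open Labelling public

data Walk {d : ℕ} : V d → V d → Set where
  stop : (x : V d) → Walk x x
  step : (x : V d) (i : Fin d) {z : V d} → Walk (flipAt i x) z → Walk x z

len : ∀ {d} {x z : V d} → Walk x z → ℕ
len (stop x) = zero
len (step x i w) = suc (len w)

verts : ∀ {d} {x z : V d} → Walk x z → List (V d)
verts (stop x) = x ∷ []
verts (step x i w) = x ∷ verts w

labels : ∀ {d} → Labelling d → {x z : V d} → Walk x z → List ℕ
labels L (stop x) = []
labels L (step x i w) = label L x i ∷ labels L w

IsPath : ∀ {d} {x z : V d} → Walk x z → Set
IsPath w = Unique (verts w)

IsTemporal : ∀ {d} → Labelling d → {x z : V d} → Walk x z → Set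
IsTemporal L w = IsPath w × Linked _<_ (labels L w)

GraphDist : ∀ {d} → V d → V d → ℕ → Set
GraphDist u v k =
  Σ (Walk u v) (λ w → IsPath w × len w ≡ k) × (∀ (w : Walk u v) → IsPath w → k ≤ len w)

TemporalDist : ∀ {d} → Labelling d → V d → V d → ℕ → Set
TemporalDist L u v k =
  Σ (Walk u v) (λ w → IsTemporal L w × len w ≡ k) × (∀ (w : Walk u v) → IsTemporal L w → k ≤ len w)

-- Label every edge in direction i by i + 1. The labels along a temporal path
-- then increase with the direction, so each coordinate is flipped at most once
-- and coordinate i is never touched again after the first step in direction i.
-- Hence a temporal path never revisits a vertex, and two temporal paths from
-- u to v cannot start in different directions: the smaller of the two
-- coordinates would end up flipped along one and fixed along the other. The
-- temporal path exists (flip the differing coordinates in increasing order)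
-- and its length is the Hamming distance, a lower bound for any walk.
module Submission where

open import Defs
open import Data.Nat using (ℕ; suc; _+_; _≤_; _<_; s≤s; z≤n)
open import Data.Nat.Properties using (≤-refl; ≤-trans; ≤-reflexive; ≤-antisym; <-trans; ≤-pred; n≤1+n; m≤n⇒m≤1+n; +-monoʳ-≤; +-suc)
open import Data.Fin using (Fin; toℕ) renaming (zero to fzero; suc to fsuc)
open import Data.Fin.Properties using (<-cmp; <-irrefl)
open import Data.Bool using (Bool; true; false; not; _xor_; if_then_else_)
open import Data.Bool.Properties using (not-¬)
open import Data.Vec using ([]; _∷_; lookup)
open import Data.Vec.Properties using (lookup∘updateAt; lookup∘updateAt′)
open import Data.List using ([]; _∷_)
open import Data.List.Relation.Unary.All as All using (All; []; _∷_)
open import Data.List.Relation.Unary.AllPairs as AllPairs using ([]; _∷_)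
open import Data.List.Relation.Unary.Linked as Linked using (Linked; []; [-]; _∷_)
open import Data.List.Relation.Unary.Linked.Properties using (Linked⇒All; Linked⇒AllPairs)
open import Data.Product using (Σ; _×_; _,_; proj₁)
open import Data.Empty using (⊥-elim)
open import Function using (_∘_)
open import Relation.Binary.Definitions using (tri<; tri≈; tri>)
open import Relation.Binary.PropositionalEquality using (_≡_; _≢_; refl; trans; cong)

directionLabelling : ∀ d → Labelling d
directionLabelling d = record
  { label     = λ _ i → suc (toℕ i)
  ; symmetric = λ _ _ → refl
  ; positive  = λ _ _ → s≤s z≤n
  }

Increasing : ∀ {d} {x z : V d} → Walk x z → Set
Increasing {d} w = Linked _<_ (labels (directionLabelling d) w)

head-<-tail : ∀ {n ns} → Linked _<_ (n ∷ ns) → All (n <_) ns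
head-<-tail = AllPairs.head ∘ Linked⇒AllPairs <-trans

suc-toℕ-<⇒≢ : ∀ {d} {c j : Fin d} → suc (toℕ c) < suc (toℕ j) → c ≢ j
suc-toℕ-<⇒≢ c<j refl = <-irrefl refl (≤-pred c<j)

module _ {d : ℕ} where

  private
    L = directionLabelling d

  lookup-fixed-on-verts : ∀ (c : Fin d) {s z : V d} (w : Walk s z) →
    All (suc (toℕ c) <_) (labels L w) → All (λ y → lookup y c ≡ lookup s c) (verts w)
  lookup-fixed-on-verts c (stop _) _ = refl ∷ []
  lookup-fixed-on-verts c (step s j w) (c<j ∷ later) =
    refl ∷ All.map (λ fixed → trans fixed (lookup∘updateAt′ c j (suc-toℕ-<⇒≢ c<j) s))
                   (lookup-fixed-on-verts c w later)

  lookup-fixed : ∀ (c : Fin d) {s z : V d} (w : Walk s z) →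
    All (suc (toℕ c) <_) (labels L w) → lookup z c ≡ lookup s c
  lookup-fixed c (stop _) _ = refl
  lookup-fixed c (step s j w) (c<j ∷ later) =
    trans (lookup-fixed c w later) (lookup∘updateAt′ c j (suc-toℕ-<⇒≢ c<j) s)

  lookup-flipped : ∀ {s z : V d} (i : Fin d) (w : Walk (flipAt i s) z) →
    Increasing (step s i w) → lookup z i ≡ not (lookup s i)
  lookup-flipped {s} i w inc = trans (lookup-fixed i w (head-<-tail inc)) (lookup∘updateAt i s)

  increasing⇒path : ∀ {s z : V d} (w : Walk s z) → Increasing w → IsPath w
  increasing⇒path (stop _) _ = [] ∷ []
  increasing⇒path (step s i w) inc =
    All.map (λ fixed s≡y → not-¬ refl
               (trans (cong (λ y → lookup y i) s≡y) (trans fixed (lookup∘updateAt i s))))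
            (lookup-fixed-on-verts i w (head-<-tail inc))
    ∷ increasing⇒path w (Linked.tail inc)

  increasing-unique : ∀ {s z : V d} (w w′ : Walk s z) → Increasing w → Increasing w′ →
    verts w ≡ verts w′
  increasing-unique (stop _) (stop _) _ _ = refl
  increasing-unique (stop _) (step _ i w′) _ inc′ = ⊥-elim (not-¬ refl (lookup-flipped i w′ inc′))
  increasing-unique (step _ i w) (stop _) inc _ = ⊥-elim (not-¬ refl (lookup-flipped i w inc))
  increasing-unique (step s i w) (step _ j w′) inc inc′ with <-cmp i j
  ... | tri≈ _ refl _ = cong (s ∷_) (increasing-unique w w′ (Linked.tail inc) (Linked.tail inc′))
  ... | tri< i<j _ _ = ⊥-elim (not-¬ (lookup-fixed i (step s j w′) (Linked⇒All <-trans (s≤s i<j) inc′))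
                                     (lookup-flipped i w inc))
  ... | tri> _ _ j<i = ⊥-elim (not-¬ (lookup-fixed j (step s i w) (Linked⇒All <-trans (s≤s j<i) inc))
                                     (lookup-flipped j w′ inc′))

hamming : ∀ {d} → V d → V d → ℕ
hamming [] [] = 0
hamming (a ∷ x) (b ∷ y) = (if a xor b then 1 else 0) + hamming x y

hamming-self : ∀ {d} (x : V d) → hamming x x ≡ 0
hamming-self [] = refl
hamming-self (false ∷ x) = hamming-self x
hamming-self (true ∷ x) = hamming-self x

hamming-flipAt : ∀ {d} (i : Fin d) (x z : V d) → hamming x z ≤ suc (hamming (flipAt i x) z)
hamming-flipAt fzero (false ∷ x) (false ∷ z) = m≤n⇒m≤1+n (n≤1+n _)
hamming-flipAt fzero (false ∷ x) (true ∷ z) = ≤-refl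
hamming-flipAt fzero (true ∷ x) (false ∷ z) = ≤-refl
hamming-flipAt fzero (true ∷ x) (true ∷ z) = m≤n⇒m≤1+n (n≤1+n _)
hamming-flipAt (fsuc i) (a ∷ x) (b ∷ z) =
  ≤-trans (+-monoʳ-≤ (if a xor b then 1 else 0) (hamming-flipAt i x z)) (≤-reflexive (+-suc _ _))

hamming≤len : ∀ {d} {x z : V d} (w : Walk x z) → hamming x z ≤ len w
hamming≤len (stop x) = ≤-reflexive (hamming-self x)
hamming≤len (step x i w) = ≤-trans (hamming-flipAt i x _) (s≤s (hamming≤len w))

lift : ∀ {d} (b : Bool) {x z : V d} → Walk x z → Walk (b ∷ x) (b ∷ z)
lift b (stop x) = stop (b ∷ x)
lift b (step x i w) = step (b ∷ x) (fsuc i) (lift b w)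

len-lift : ∀ {d} (b : Bool) {x z : V d} (w : Walk x z) → len (lift b w) ≡ len w
len-lift b (stop _) = refl
len-lift b (step _ _ w) = cong suc (len-lift b w)

increasing-lift : ∀ {d} (b : Bool) {x z : V d} (w : Walk x z) → Increasing w → Increasing (lift b w)
increasing-lift b (stop _) _ = []
increasing-lift b (step _ _ (stop _)) _ = [-]
increasing-lift b (step _ _ w@(step _ _ _)) (i<j ∷ inc) = s≤s i<j ∷ increasing-lift b w inc

increasing-flipHead-lift : ∀ {d} (a : Bool) {x z : V d} (w : Walk x z) → Increasing w →
  Increasing (step (a ∷ x) fzero (lift (not a) w))
increasing-flipHead-lift a (stop _) _ = [-]
increasing-flipHead-lift a w@(step _ _ _) inc = s≤s (s≤s z≤n) ∷ increasing-lift (not a) w inc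

alignHead : ∀ {d} (a b : Bool) {x : V d} {z : V (suc d)} → Walk (b ∷ x) z → Walk (a ∷ x) z
alignHead false false w = w
alignHead true  true  w = w
alignHead false true  w = step _ fzero w
alignHead true  false w = step _ fzero w

len-alignHead : ∀ {d} (a b : Bool) {x : V d} {z : V (suc d)} (w : Walk (b ∷ x) z) →
  len (alignHead a b w) ≡ (if a xor b then 1 else 0) + len w
len-alignHead false false w = refl
len-alignHead true  true  w = refl
len-alignHead false true  w = refl
len-alignHead true  false w = refl

canonical : ∀ {d} (x z : V d) → Walk x z
canonical [] [] = stop []
canonical (a ∷ x) (b ∷ z) = alignHead a b (lift b (canonical x z))

len-canonical : ∀ {d} (x z : V d) → len (canonical x z) ≡ hamming x z
len-canonical [] [] = refl
len-canonical (a ∷ x) (b ∷ z) = trans (len-alignHead a b (lift b (canonical x z)))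
  (cong ((if a xor b then 1 else 0) +_) (trans (len-lift b (canonical x z)) (len-canonical x z)))

canonical-shortest : ∀ {d} {x z : V d} (w : Walk x z) → len (canonical x z) ≤ len w
canonical-shortest {x = x} {z} w = ≤-trans (≤-reflexive (len-canonical x z)) (hamming≤len w)

increasing-canonical : ∀ {d} (x z : V d) → Increasing (canonical x z)
increasing-canonical [] [] = []
increasing-canonical (false ∷ x) (false ∷ z) = increasing-lift false (canonical x z) (increasing-canonical x z)
increasing-canonical (true ∷ x) (true ∷ z) = increasing-lift true (canonical x z) (increasing-canonical x z)
increasing-canonical (false ∷ x) (true ∷ z) = increasing-flipHead-lift false (canonical x z) (increasing-canonical x z)
increasing-canonical (true ∷ x) (false ∷ z) = increasing-flipHead-lift true (canonical x z) (increasing-canonical x z)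

temporal-canonical : ∀ {d} (x z : V d) → IsTemporal (directionLabelling d) (canonical x z)
temporal-canonical x z = increasing⇒path (canonical x z) (increasing-canonical x z) , increasing-canonical x z

lemma3 : (d : ℕ) → Σ (Labelling d) λ L →
    (∀ (u v : V d) (k : ℕ) → GraphDist u v k → TemporalDist L u v k)
  × (∀ (u v : V d) → u ≢ v →
        Σ (Walk u v) (IsTemporal L)
      × (∀ (w w′ : Walk u v) → IsTemporal L w → IsTemporal L w′ → verts w ≡ verts w′))
  × (∀ (u : V d) (i : Fin d) (w : Walk u (flipAt i u)) → IsTemporal L w →
        verts w ≡ u ∷ flipAt i u ∷ [])
lemma3 d = directionLabelling d , distance , uniqueness , adjacent
  where
  distance : ∀ (u v : V d) (k : ℕ) → GraphDist u v k → TemporalDist (directionLabelling d) u v k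
  distance u v _ ((p , _ , refl) , shortest) =
      ( canonical u v
      , temporal-canonical u v
      , ≤-antisym (canonical-shortest p) (shortest (canonical u v) (proj₁ (temporal-canonical u v))))
    , λ w → shortest w ∘ proj₁

  uniqueness : ∀ (u v : V d) → u ≢ v →
      Σ (Walk u v) (IsTemporal (directionLabelling d))
    × (∀ (w w′ : Walk u v) → IsTemporal (directionLabelling d) w → IsTemporal (directionLabelling d) w′ →
          verts w ≡ verts w′)
  uniqueness u v _ = (canonical u v , temporal-canonical u v) ,
    λ w w′ (_ , inc) (_ , inc′) → increasing-unique w w′ inc inc′

  adjacent : ∀ (u : V d) (i : Fin d) (w : Walk u (flipAt i u)) → IsTemporal (directionLabelling d) w →
    verts w ≡ u ∷ flipAt i u ∷ []
  adjacent u i w (_ , inc) = increasing-unique w (step u i (stop _)) inc [-]
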